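{- Let $T=(S,\{\theta_t:t\in\Theta\},V)$ be a transition model, and let $T^{DL}$, $\phi^{DL}_x$ and $\tau^{DL}_x(P)$ be as defined in the context. Then for every Transition Logic formula $\phi$, every Transition Logic term $\tau$, every variable $x$, every set $P\subseteq S$ and every team $X$ over $T^{DL}$ whose domain contains $x$ and with $X(x)\subseteq S$: \[ T^{DL}\models_X\phi^{DL}_x \iff T\models_{X(x)}\phi \] and \[ T^{DL}\models_X\tau^{DL}_x(P) \iff T\models_{X(x)\rightarrow P}\tau, \] where in the second equivalence the unary relation symbol $P$ is interpreted as the set $P$.
   Context: Transition Logic (TL). A transition system over a nonempty set $S$ is a nonempty $\theta\subseteq\mathcal P(S)\times\mathcal P(S)$ that is downwards closed in the first coordinate, upward closed in the second, contains $(\emptyset,Y)$ for all $Y$, and contains no $(X,\emptyset)$ with $X\neq\emptyset$; a trump over $S$ is a nonempty downwards closed family of subsets of $S$. A transition model is $T=(S,\{\theta_t:t\in\Theta\},V)$ with $S$ nonempty, each $\theta_t$ a transition system and each $V(p)$ ($p\in\Phi$, the atomic propositions) a trump. TL terms: $\tau ::= t\mid\phi?\mid\tau\otimes\tau\mid\tau\cap\tau\mid\tau;\tau$; formulas $\phi ::= \top\mid p\mid\phi\vee\phi\mid\phi\wedge\phi\mid\langle\tau\rangle\phi$. Semantics for $X,Y\subseteq S$: $T\models_{X\rightarrow Y}t$ iff $(X,Y)\in\theta_t$; $T\models_{X\rightarrow Y}\phi?$ iff $T\models_X\phi$ and $X\subseteq Y$; $T\models_{X\rightarrow Y}\tau_1\otimes\tau_2$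 iff $X=X_1\cup X_2$ with $T\models_{X_1\rightarrow Y}\tau_1$, $T\models_{X_2\rightarrow Y}\tau_2$; $\cap$ requires both; $T\models_{X\rightarrow Y}\tau_1;\tau_2$ iff some $Z$ has $T\models_{X\rightarrow Z}\tau_1$, $T\models_{Z\rightarrow Y}\tau_2$; $T\models_X\top$ always; $T\models_Xp$ iff $X\in V(p)$; $\vee$, $\wedge$ classical; $T\models_X\langle\tau\rangle\psi$ iff some $Y$ has $T\models_{X\rightarrow Y}\tau$ and $T\models_Y\psi$. Dependence Logic (DL) with team semantics: assignments are functions from finite sets of variables to the domain; a team is a set of assignments with common domain; $X(x)=\{s(x):s\in X\}$; $s[m/v]$, $X[F/v]=\{s[F(s)/v]:s\in X\}$, $X[M/v]=\{s[m/v]:s\in X,m\in\mathrm{dom}(M)\}$. Formulas $R\vec t\mid\lnot R\vec t\mid=\!(t_1,\ldots,t_n)\mid\phi\vee\phi\mid\phi\wedge\phi\mid\exists v\phi\mid\forall v\phi$ with: literals hold iff they hold for every $s\in X$; $=\!(t_1,\ldots,t_n)$ holds iff any $s,s'\in X$ agreeing on the values of $t_1,\ldots,t_{n-1}$ agree on $t_n$ (so $=\!(t)$ says $t$ is constant on $X$); $\psi_1\vee\psi_2$ iff $X=Y_1\cup Y_2$ with $Y_i$ satisfying $\psi_i$; $\wedge$ both; $\exists v\psi$ iff $M\models_{X[F/v]}\psi$ for some $F:X\to\mathrm{dom}(M)$; $\forall v\psi$ iff $M\models_{X[M/v]}\psi$. We also allow second-order existential quantification: $M\models_X\exists P\,\phi$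 iff there is a relation $P$ on $\mathrm{dom}(M)$ of the right arity such that $(M,P)\models_X\phi$. Classical disjunction: $\psi_1\sqcup\psi_2 := \exists u_1\exists u_2(=\!(u_1)\wedge=\!(u_2)\wedge((u_1=u_2\wedge\psi_1)\vee(u_1\neq u_2\wedge\psi_2)))$ with $u_1,u_2$ new variables. The model $T^{DL}$: write $\theta_t=\{(X_i,Y_i):i\in I_t\}$ (an injective enumeration) for each $t\in\Theta$ and $V(p)=\{X_j:j\in J_p\}$ for each $p\in\Phi$. $T^{DL}$ has domain the disjoint union $S\uplus\biguplus_{t}I_t\uplus\biguplus_pJ_p$, a ternary relation $R_t=\{(i,a,b):i\in I_t,a\in X_i,b\in Y_i\}$ for each $t\in\Theta$, and a binary relation $V_p=\{(j,a):j\in J_p,a\in X_j\}$ for each $p\in\Phi$. Translations (all of $i,j,y$ and quantified relation symbols are fresh): $\top^{DL}_x=\top$ (satisfied by every team); $p^{DL}_x=\exists j(=\!(j)\wedge V_p(j,x))$; $(\psi_1\vee\psi_2)^{DL}_x=(\psi_1)^{DL}_x\sqcup(\psi_2)^{DL}_x$; $(\psi_1\wedge\psi_2)^{DL}_x=(\psi_1)^{DL}_x\wedge(\psi_2)^{DL}_x$; $(\langle\tau\rangle\psi)^{DL}_x=\exists P(\tau^{DL}_x(P)\wedge\forall y(\lnot Py\vee\psi^{DL}_y))$. For a unary relation symbol $P$: $t^{DL}_x(P)=\exists i(=\!(i)\wedge\exists y\,R_t(i,x,y)\wedge\forall y(\lnot R_t(i,x,y)\vee Py))$; $(\phi?)^{DL}_x(P)=\phi^{DL}_x\wedge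 Px$; $(\tau_1\otimes\tau_2)^{DL}_x(P)=(\tau_1)^{DL}_x(P)\vee(\tau_2)^{DL}_x(P)$; $(\tau_1\cap\tau_2)^{DL}_x(P)=(\tau_1)^{DL}_x(P)\wedge(\tau_2)^{DL}_x(P)$; $(\tau_1;\tau_2)^{DL}_x(P)=\exists Q((\tau_1)^{DL}_x(Q)\wedge\forall y(\lnot Qy\vee(\tau_2)^{DL}_y(P)))$. -}

module Defs where

open import Level using (Level; 0ℓ) renaming (suc to lsuc)
open import Data.Nat using (ℕ; zero; suc; _≡ᵇ_; _⊔_)
open import Data.Bool using (if_then_else_)
open import Data.Empty using (⊥)
open import Data.Unit using (⊤)
open import Data.Product using (Σ; _×_; _,_; ∃)
open import Data.Sum using (_⊎_; inj₁; inj₂)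
open import Data.List using (List; [])
open import Data.List.Relation.Unary.All using (All)
open import Relation.Nullary using (¬_)
open import Relation.Binary.PropositionalEquality using (_≡_)

Sub : Set → Set₁
Sub A = A → Set

_⊆_ : {A : Set} → Sub A → Sub A → Set
X ⊆ Y = ∀ a → X a → Y a

_≐_ : {A : Set} → Sub A → Sub A → Set
X ≐ Y = (X ⊆ Y) × (Y ⊆ X)

_∪_ : {A : Set} → Sub A → Sub A → Sub A
(X ∪ Y) a = X a ⊎ Y a

∅ : {A : Set} → Sub A
∅ _ = ⊥

record IsTransitionSystem {S : Set} (θ : Sub S → Sub S → Set) : Set₁ where
  field
    nonempty   : Σ (Sub S) λ X → Σ (Sub S) λ Y → θ X Y
    downFirst  : ∀ X X' Y → θ X Y → X' ⊆ X → θ X' Y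
    upSecond   : ∀ X Y Y' → θ X Y → Y ⊆ Y' → θ X Y'
    emptyFirst : ∀ Y → θ ∅ Y
    noEmptySecond : ∀ X → θ X ∅ → ∀ a → ¬ X a

record IsTrump {S : Set} (V : Sub S → Set) : Set₁ where
  field
    nonempty : Σ (Sub S) λ X → V X
    downClosed : ∀ X X' → V X → X' ⊆ X → V X'

record TransitionModel (Θ Φ : Set) : Set₁ where
  field
    S     : Set
    point : S                       -- S is nonempty
    θ     : Θ → Sub S → Sub S → Set
    θ-ts  : ∀ t → IsTransitionSystem (θ t)
    V     : Φ → Sub S → Set
    V-tr  : ∀ p → IsTrump (V p)

mutual
  data TLTerm (Θ Φ : Set) : Set where
    act  : Θ → TLTerm Θ Φ
    test : TLForm Θ Φ → TLTerm Θ Φ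
    _⊗_  : TLTerm Θ Φ → TLTerm Θ Φ → TLTerm Θ Φ
    _∩_  : TLTerm Θ Φ → TLTerm Θ Φ → TLTerm Θ Φ
    _⨾_  : TLTerm Θ Φ → TLTerm Θ Φ → TLTerm Θ Φ

  data TLForm (Θ Φ : Set) : Set where
    ⊤ᶠ   : TLForm Θ Φ
    atom : Φ → TLForm Θ Φ
    _∨ᶠ_ : TLForm Θ Φ → TLForm Θ Φ → TLForm Θ Φ
    _∧ᶠ_ : TLForm Θ Φ → TLForm Θ Φ → TLForm Θ Φ
    ⟨_⟩_ : TLTerm Θ Φ → TLForm Θ Φ → TLForm Θ Φ

module TLSem {Θ Φ : Set} (T : TransitionModel Θ Φ) where
  open TransitionModel T

  mutual
    satT : TLTerm Θ Φ → Sub S → Sub S → Set₁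
    satT (act t)   X Y = Level.Lift (lsuc 0ℓ) (θ t X Y)
    satT (test φ)  X Y = satF φ X × Level.Lift (lsuc 0ℓ) (X ⊆ Y)
    satT (τ₁ ⊗ τ₂) X Y = Σ (Sub S) λ X₁ → Σ (Sub S) λ X₂ →
      Level.Lift (lsuc 0ℓ) (X ≐ (X₁ ∪ X₂)) × satT τ₁ X₁ Y × satT τ₂ X₂ Y
    satT (τ₁ ∩ τ₂) X Y = satT τ₁ X Y × satT τ₂ X Y
    satT (τ₁ ⨾ τ₂) X Y = Σ (Sub S) λ Z → satT τ₁ X Z × satT τ₂ Z Y

    satF : TLForm Θ Φ → Sub S → Set₁
    satF ⊤ᶠ        X = Level.Lift (lsuc 0ℓ) ⊤
    satF (atom p)  X = Level.Lift (lsuc 0ℓ) (V p X)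
    satF (φ ∨ᶠ ψ)  X = satF φ X ⊎ satF ψ X
    satF (φ ∧ᶠ ψ)  X = satF φ X × satF ψ X
    satF (⟨ τ ⟩ ψ) X = Σ (Sub S) λ Y → satT τ X Y × satF ψ Y

Var : Set
Var = ℕ

RVar : Set
RVar = ℕ

data DLForm (Θ Φ : Set) : Set where
  ⊤ᵈ    : DLForm Θ Φ
  R     : Θ → Var → Var → Var → DLForm Θ Φ
  ¬R    : Θ → Var → Var → Var → DLForm Θ Φ
  Vr    : Φ → Var → Var → DLForm Θ Φ
  ¬Vr   : Φ → Var → Var → DLForm Θ Φ
  Pr    : RVar → Var → DLForm Θ Φ
  ¬Pr   : RVar → Var → DLForm Θ Φ
  eq    : Var → Var → DLForm Θ Φ
  neq   : Var → Var → DLForm Θ Φ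
  dep   : List Var → Var → DLForm Θ Φ
  _∨ᵈ_  : DLForm Θ Φ → DLForm Θ Φ → DLForm Θ Φ
  _∧ᵈ_  : DLForm Θ Φ → DLForm Θ Φ → DLForm Θ Φ
  ∃ᵈ    : Var → DLForm Θ Φ → DLForm Θ Φ
  ∀ᵈ    : Var → DLForm Θ Φ → DLForm Θ Φ
  ∃²    : RVar → DLForm Θ Φ → DLForm Θ Φ

const : {Θ Φ : Set} → Var → DLForm Θ Φ
const v = dep [] v

record Structure (Θ Φ : Set) : Set₁ where
  field
    D  : Set
    Rᴹ : Θ → D → D → D → Set
    Vᴹ : Φ → D → D → Set

-- assignments (total; values of variables outside the intended domain are irrelevant)
Assign : Set → Set
Assign D = Var → D

_[_↦_] : {D : Set} → Assign D → Var → D → Assign D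
(s [ v ↦ d ]) w = if w ≡ᵇ v then d else s w

_[_↦ᴿ_] : {D : Set} → (RVar → Sub D) → RVar → Sub D → (RVar → Sub D)
(ρ [ P ↦ᴿ Q ]) w = if w ≡ᵇ P then Q else ρ w

Team : Set → Set₁
Team D = Sub (Assign D)

_≗ₐ_ : {D : Set} → Assign D → Assign D → Set
s ≗ₐ s' = ∀ v → s v ≡ s' v

supplement : {D : Set} (X : Team D) → Var → ((s : Assign D) → X s → D) → Team D
supplement {D} X v F s' = Σ (Assign D) λ s → Σ (X s) λ h → s' ≗ₐ (s [ v ↦ F s h ])

duplicate : {D : Set} (X : Team D) → Var → Team D
duplicate {D} X v s' = Σ (Assign D) λ s → X s × Σ D λ m → s' ≗ₐ (s [ v ↦ m ])

module DLSem {Θ Φ : Set} (M : Structure Θ Φ) where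
  open Structure M

  sat : (RVar → Sub D) → DLForm Θ Φ → Team D → Set₁
  sat ρ ⊤ᵈ            X = Level.Lift (lsuc 0ℓ) ⊤
  sat ρ (R t a b c)   X = Level.Lift (lsuc 0ℓ) (∀ s → X s → Rᴹ t (s a) (s b) (s c))
  sat ρ (¬R t a b c)  X = Level.Lift (lsuc 0ℓ) (∀ s → X s → ¬ Rᴹ t (s a) (s b) (s c))
  sat ρ (Vr p a b)    X = Level.Lift (lsuc 0ℓ) (∀ s → X s → Vᴹ p (s a) (s b))
  sat ρ (¬Vr p a b)   X = Level.Lift (lsuc 0ℓ) (∀ s → X s → ¬ Vᴹ p (s a) (s b))
  sat ρ (Pr P a)      X = Level.Lift (lsuc 0ℓ) (∀ s → X s → ρ P (s a))
  sat ρ (¬Pr P a)     X = Level.Lift (lsuc 0ℓ) (∀ s → X s → ¬ ρ P (s a))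
  sat ρ (eq a b)      X = Level.Lift (lsuc 0ℓ) (∀ s → X s → s a ≡ s b)
  sat ρ (neq a b)     X = Level.Lift (lsuc 0ℓ) (∀ s → X s → ¬ s a ≡ s b)
  sat ρ (dep vs v)    X = Level.Lift (lsuc 0ℓ)
    (∀ s s' → X s → X s' → All (λ w → s w ≡ s' w) vs → s v ≡ s' v)
  sat ρ (φ ∨ᵈ ψ)      X = Σ (Team D) λ Y₁ → Σ (Team D) λ Y₂ →
    Level.Lift (lsuc 0ℓ) (X ≐ (Y₁ ∪ Y₂)) × sat ρ φ Y₁ × sat ρ ψ Y₂
  sat ρ (φ ∧ᵈ ψ)      X = sat ρ φ X × sat ρ ψ X
  sat ρ (∃ᵈ v φ)      X = Σ ((s : Assign D) → X s → D) λ F → sat ρ φ (supplement X v F)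
  sat ρ (∀ᵈ v φ)      X = sat ρ φ (duplicate X v)
  sat ρ (∃² P φ)      X = Σ (Sub D) λ Q → sat (ρ [ P ↦ᴿ Q ]) φ X

-- Classical disjunction ψ₁ ⊔ ψ₂ with new variables u₁ u₂

cdisj : {Θ Φ : Set} → Var → Var → DLForm Θ Φ → DLForm Θ Φ → DLForm Θ Φ
cdisj u₁ u₂ ψ₁ ψ₂ =
  ∃ᵈ u₁ (∃ᵈ u₂ ((const u₁ ∧ᵈ const u₂) ∧ᵈ
    ((eq u₁ u₂ ∧ᵈ ψ₁) ∨ᵈ (neq u₁ u₂ ∧ᵈ ψ₂))))

-- The translations.  The extra ℕ argument n is a supply of fresh names:
-- all new individual variables / relation variables used are ≥ n.

mutual
  trF : {Θ Φ : Set} → TLForm Θ Φ → Var → ℕ → DLForm Θ Φ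
  trF ⊤ᶠ        x n = ⊤ᵈ
  trF (atom p)  x n = ∃ᵈ n (const n ∧ᵈ Vr p n x)
  trF (φ ∨ᶠ ψ)  x n = cdisj n (suc n) (trF φ x (suc (suc n))) (trF ψ x (suc (suc n)))
  trF (φ ∧ᶠ ψ)  x n = trF φ x n ∧ᵈ trF ψ x n
  trF (⟨ τ ⟩ ψ) x n =
    ∃² n (trT τ x n (suc n) ∧ᵈ ∀ᵈ n (¬Pr n n ∨ᵈ trF ψ n (suc n)))

  trT : {Θ Φ : Set} → TLTerm Θ Φ → Var → RVar → ℕ → DLForm Θ Φ
  trT (act t)   x P n =
    ∃ᵈ n (const n ∧ᵈ (∃ᵈ (suc n) (R t n x (suc n))
                     ∧ᵈ ∀ᵈ (suc n) (¬R t n x (suc n) ∨ᵈ Pr P (suc n))))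
  trT (test φ)  x P n = trF φ x n ∧ᵈ Pr P x
  trT (τ₁ ⊗ τ₂) x P n = trT τ₁ x P n ∨ᵈ trT τ₂ x P n
  trT (τ₁ ∩ τ₂) x P n = trT τ₁ x P n ∧ᵈ trT τ₂ x P n
  trT (τ₁ ⨾ τ₂) x P n =
    ∃² n (trT τ₁ x n (suc n) ∧ᵈ ∀ᵈ n (¬Pr n n ∨ᵈ trT τ₂ n P (suc n)))

_ᴰᴸ[_] : {Θ Φ : Set} → TLForm Θ Φ → Var → DLForm Θ Φ
φ ᴰᴸ[ x ] = trF φ x (suc x)

_ᴰᴸ[_,_] : {Θ Φ : Set} → TLTerm Θ Φ → Var → RVar → DLForm Θ Φ
τ ᴰᴸ[ x , P ] = trT τ x P (suc (x ⊔ P))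

record Enumeration {Θ Φ : Set} (T : TransitionModel Θ Φ) : Set₁ where
  open TransitionModel T
  field
    I      : Θ → Set
    Xᵢ     : (t : Θ) → I t → Sub S
    Yᵢ     : (t : Θ) → I t → Sub S
    I-sound : ∀ t i → θ t (Xᵢ t i) (Yᵢ t i)
    I-complete : ∀ t X Y → θ t X Y → Σ (I t) λ i → (Xᵢ t i ≐ X) × (Yᵢ t i ≐ Y)
    I-injective : ∀ t i i' → Xᵢ t i ≐ Xᵢ t i' → Yᵢ t i ≐ Yᵢ t i' → i ≡ i'
    J      : Φ → Set
    Xⱼ     : (p : Φ) → J p → Sub S
    J-sound : ∀ p j → V p (Xⱼ p j)
    J-complete : ∀ p X → V p X → Σ (J p) λ j → Xⱼ p j ≐ X
    J-injective : ∀ p j j' → Xⱼ p j ≐ Xⱼ p j' → j ≡ j'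

module _ {Θ Φ : Set} (T : TransitionModel Θ Φ) (E : Enumeration T) where
  open TransitionModel T
  open Enumeration E

  Dom : Set
  Dom = S ⊎ (Σ Θ I ⊎ Σ Φ J)

  Rᴰᴸ : Θ → Dom → Dom → Dom → Set
  Rᴰᴸ t (inj₂ (inj₁ (t' , i))) (inj₁ a) (inj₁ b) = (t ≡ t') × Xᵢ t' i a × Yᵢ t' i b
  Rᴰᴸ t _ _ _ = ⊥

  Vᴰᴸ : Φ → Dom → Dom → Set
  Vᴰᴸ p (inj₂ (inj₂ (p' , j))) (inj₁ a) = (p ≡ p') × Xⱼ p' j a
  Vᴰᴸ p _ _ = ⊥

  Tᴰᴸ : Structure Θ Φ
  Tᴰᴸ = record { D = Dom ; Rᴹ = Rᴰᴸ ; Vᴹ = Vᴰᴸ }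

  embedSub : Sub S → Sub Dom
  embedSub P (inj₁ a) = P a
  embedSub P (inj₂ _) = ⊥

  -- X(x), as a subset of S (values outside S are discarded)
  valuesIn : Team Dom → Var → Sub S
  valuesIn X x a = Σ (Assign Dom) λ s → X s × (s x ≡ inj₁ a)

  ValuesInS : Team Dom → Var → Set
  ValuesInS X x = ∀ s → X s → Σ S λ a → s x ≡ inj₁ a

module Submission where

-- Both equivalences are proved together by induction on formulas and terms, for every supply of
-- fresh names and every interpretation of the relation variables; the invariant is that the
-- translation at x only sees the set X(x) of values of x. Since TL and DL are both downward closed,
-- teams can be shrunk freely. A constant variable (=(i), =(j)) names the single index in I_t or J_p
-- whose pair or set encodes the transition or trump element. For ⟨τ⟩ψ and τ₁;τ₂, the quantified
-- relation P is the intermediate state set, and ∀y(¬Py ∨ ψ) evaluates ψ on the team of all y ∈ P.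
-- Excluded middle is used to split teams pointwise and to treat empty teams separately.

open import Defs
open import Level using (0ℓ; Lift; lift; lower) renaming (suc to lsuc)
open import Data.Nat using (zero; suc; _≡ᵇ_; _<_; s≤s)
open import Data.Nat.Properties using (<⇒≢; 1+n≢n; m<n⇒m<1+n; n<1+n; m≤m⊔n; m≤n⊔m)
open import Data.Bool using (if_then_else_)
open import Data.Product using (Σ; _×_; proj₁; proj₂) renaming (map to ×-map)
open import Data.Sum using (_⊎_; inj₁; inj₂; [_,_]; swap) renaming (map to ⊎-map)
open import Data.Sum.Properties using (inj₁-injective)
open import Data.Empty using (⊥; ⊥-elim)
open import Data.Unit using (tt)
open import Data.List.Relation.Unary.All using ([])
open import Relation.Nullary using (¬_; Dec; yes; no)
open import Relation.Nullary.Decidable using (toSum)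
open import Relation.Binary.PropositionalEquality using (_≡_; _≢_; ≢-sym; refl; sym; trans; cong; subst)
open import Function using (id; _∘_)
open import Function.Bundles using (_⇔_; mk⇔; Equivalence)
open import Axiom.ExcludedMiddle using (ExcludedMiddle)

-- `_,_` is kept out of the top-level scope, where it would make `τ ᴰᴸ[ x , Pv ]` ambiguous.
module TranslationCorrectness where

  open Data.Product using (_,_)
  open Equivalence using (to; from)

  if-≡ᵇ-refl : ∀ {a} {A : Set a} v {x y : A} → (if v ≡ᵇ v then x else y) ≡ x
  if-≡ᵇ-refl zero    = refl
  if-≡ᵇ-refl (suc v) = if-≡ᵇ-refl v

  if-≡ᵇ-≢ : ∀ {a} {A : Set a} w v {x y : A} → w ≢ v → (if w ≡ᵇ v then x else y) ≡ y
  if-≡ᵇ-≢ zero    zero    w≢v = ⊥-elim (w≢v refl)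
  if-≡ᵇ-≢ zero    (suc v) _   = refl
  if-≡ᵇ-≢ (suc w) zero    _   = refl
  if-≡ᵇ-≢ (suc w) (suc v) w≢v = if-≡ᵇ-≢ w v (w≢v ∘ cong suc)

  restrict-∪ : {A : Set} {X X₁ X₂ X' : Sub A} → X ≐ (X₁ ∪ X₂) → X' ⊆ X →
               X' ≐ ((λ a → X' a × X₁ a) ∪ (λ a → X' a × X₂ a))
  restrict-∪ (X⊆X₁∪X₂ , _) X'⊆X =
    (λ a x' → ⊎-map (x' ,_) (x' ,_) (X⊆X₁∪X₂ a (X'⊆X a x'))) , (λ a → [ proj₁ , proj₁ ])

  ∪-idem : {A : Set} (X : Sub A) → X ≐ (X ∪ X)
  ∪-idem X = (λ _ → inj₁) , (λ _ → [ id , id ])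

  module TLProperties {Θ Φ : Set} (T : TransitionModel Θ Φ) where
    open TransitionModel T
    open TLSem T
    open IsTransitionSystem
    open IsTrump

    mutual
      satF-antimono : ∀ φ {X X'} → X' ⊆ X → satF φ X → satF φ X'
      satF-antimono ⊤ᶠ        _    h                = h
      satF-antimono (atom p)  X'⊆X (lift h)         = lift (downClosed (V-tr p) _ _ h X'⊆X)
      satF-antimono (φ ∨ᶠ ψ)  X'⊆X                  = ⊎-map (satF-antimono φ X'⊆X) (satF-antimono ψ X'⊆X)
      satF-antimono (φ ∧ᶠ ψ)  X'⊆X                  = ×-map (satF-antimono φ X'⊆X) (satF-antimono ψ X'⊆X)
      satF-antimono (⟨ τ ⟩ ψ) X'⊆X (Y , hτ , hψ)    = Y , satT-antimonoˡ τ X'⊆X hτ , hψ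

      satT-antimonoˡ : ∀ τ {X X' Y} → X' ⊆ X → satT τ X Y → satT τ X' Y
      satT-antimonoˡ (act t)   X'⊆X (lift h)           = lift (downFirst (θ-ts t) _ _ _ h X'⊆X)
      satT-antimonoˡ (test φ)  X'⊆X (h , lift X⊆Y)     = satF-antimono φ X'⊆X h , lift (λ a → X⊆Y a ∘ X'⊆X a)
      satT-antimonoˡ (τ₁ ⊗ τ₂) X'⊆X (_ , _ , lift X≐ , h₁ , h₂) =
        _ , _ , lift (restrict-∪ X≐ X'⊆X) ,
        satT-antimonoˡ τ₁ (λ _ → proj₂) h₁ , satT-antimonoˡ τ₂ (λ _ → proj₂) h₂
      satT-antimonoˡ (τ₁ ∩ τ₂) X'⊆X                    = ×-map (satT-antimonoˡ τ₁ X'⊆X) (satT-antimonoˡ τ₂ X'⊆X)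
      satT-antimonoˡ (τ₁ ⨾ τ₂) X'⊆X (Z , h₁ , h₂)      = Z , satT-antimonoˡ τ₁ X'⊆X h₁ , h₂

    satT-monoʳ : ∀ τ {X Y Y'} → Y ⊆ Y' → satT τ X Y → satT τ X Y'
    satT-monoʳ (act t)   Y⊆Y' (lift h)          = lift (upSecond (θ-ts t) _ _ _ h Y⊆Y')
    satT-monoʳ (test φ)  Y⊆Y' (h , lift X⊆Y)    = h , lift (λ a → Y⊆Y' a ∘ X⊆Y a)
    satT-monoʳ (τ₁ ⊗ τ₂) Y⊆Y' (X₁ , X₂ , X≐ , h₁ , h₂) =
      X₁ , X₂ , X≐ , satT-monoʳ τ₁ Y⊆Y' h₁ , satT-monoʳ τ₂ Y⊆Y' h₂
    satT-monoʳ (τ₁ ∩ τ₂) Y⊆Y'                   = ×-map (satT-monoʳ τ₁ Y⊆Y') (satT-monoʳ τ₂ Y⊆Y')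
    satT-monoʳ (τ₁ ⨾ τ₂) Y⊆Y' (Z , h₁ , h₂)     = Z , h₁ , satT-monoʳ τ₂ Y⊆Y' h₂

    mutual
      satF-empty : ∀ φ {X} → (∀ a → ¬ X a) → satF φ X
      satF-empty ⊤ᶠ        _     = lift tt
      satF-empty (atom p)  X-empty =
        lift (downClosed (V-tr p) _ _ (proj₂ (nonempty (V-tr p))) (λ a → ⊥-elim ∘ X-empty a))
      satF-empty (φ ∨ᶠ ψ)  X-empty = inj₁ (satF-empty φ X-empty)
      satF-empty (φ ∧ᶠ ψ)  X-empty = satF-empty φ X-empty , satF-empty ψ X-empty
      satF-empty (⟨ τ ⟩ ψ) X-empty = ∅ , satT-empty τ X-empty , satF-empty ψ (λ _ ())

      satT-empty : ∀ τ {X Y} → (∀ a → ¬ X a) → satT τ X Y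
      satT-empty (act t)   X-empty =
        lift (downFirst (θ-ts t) ∅ _ _ (emptyFirst (θ-ts t) _) (λ a → ⊥-elim ∘ X-empty a))
      satT-empty (test φ)  X-empty = satF-empty φ X-empty , lift (λ a → ⊥-elim ∘ X-empty a)
      satT-empty (τ₁ ⊗ τ₂) X-empty = _ , _ , lift (∪-idem _) , satT-empty τ₁ X-empty , satT-empty τ₂ X-empty
      satT-empty (τ₁ ∩ τ₂) X-empty = satT-empty τ₁ X-empty , satT-empty τ₂ X-empty
      satT-empty (τ₁ ⨾ τ₂) X-empty = ∅ , satT-empty τ₁ X-empty , satT-empty τ₂ (λ _ ())

    module Degenerate (noAction : Θ → ⊥) (noAtom : Φ → ⊥) where
      mutual
        satF-degenerate : ∀ φ X → satF φ X
        satF-degenerate ⊤ᶠ        X = lift tt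
        satF-degenerate (atom p)  X = ⊥-elim (noAtom p)
        satF-degenerate (φ ∨ᶠ ψ)  X = inj₁ (satF-degenerate φ X)
        satF-degenerate (φ ∧ᶠ ψ)  X = satF-degenerate φ X , satF-degenerate ψ X
        satF-degenerate (⟨ τ ⟩ ψ) X = X , satT-degenerate-refl τ X , satF-degenerate ψ X

        satT-degenerate-refl : ∀ τ X → satT τ X X
        satT-degenerate-refl (act t)   X = ⊥-elim (noAction t)
        satT-degenerate-refl (test φ)  X = satF-degenerate φ X , lift (λ _ x → x)
        satT-degenerate-refl (τ₁ ⊗ τ₂) X =
          X , X , lift (∪-idem X) , satT-degenerate-refl τ₁ X , satT-degenerate-refl τ₂ X
        satT-degenerate-refl (τ₁ ∩ τ₂) X = satT-degenerate-refl τ₁ X , satT-degenerate-refl τ₂ X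
        satT-degenerate-refl (τ₁ ⨾ τ₂) X = X , satT-degenerate-refl τ₁ X , satT-degenerate-refl τ₂ X

  module DLProperties {Θ Φ : Set} (M : Structure Θ Φ) where
    open Structure M
    open DLSem M

    sat-antimono : ∀ ρ φ {X X' : Team D} → X' ⊆ X → sat ρ φ X → sat ρ φ X'
    sat-antimono ρ ⊤ᵈ           _    h        = h
    sat-antimono ρ (R t a b c)  X'⊆X (lift h) = lift (λ s → h s ∘ X'⊆X s)
    sat-antimono ρ (¬R t a b c) X'⊆X (lift h) = lift (λ s → h s ∘ X'⊆X s)
    sat-antimono ρ (Vr p a b)   X'⊆X (lift h) = lift (λ s → h s ∘ X'⊆X s)
    sat-antimono ρ (¬Vr p a b)  X'⊆X (lift h) = lift (λ s → h s ∘ X'⊆X s)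
    sat-antimono ρ (Pr P a)     X'⊆X (lift h) = lift (λ s → h s ∘ X'⊆X s)
    sat-antimono ρ (¬Pr P a)    X'⊆X (lift h) = lift (λ s → h s ∘ X'⊆X s)
    sat-antimono ρ (eq a b)     X'⊆X (lift h) = lift (λ s → h s ∘ X'⊆X s)
    sat-antimono ρ (neq a b)    X'⊆X (lift h) = lift (λ s → h s ∘ X'⊆X s)
    sat-antimono ρ (dep vs v)   X'⊆X (lift h) = lift (λ s s' hs hs' → h s s' (X'⊆X s hs) (X'⊆X s' hs'))
    sat-antimono ρ (φ ∨ᵈ ψ)     X'⊆X (_ , _ , lift X≐ , h₁ , h₂) =
      _ , _ , lift (restrict-∪ X≐ X'⊆X) ,
      sat-antimono ρ φ (λ _ → proj₂) h₁ , sat-antimono ρ ψ (λ _ → proj₂) h₂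
    sat-antimono ρ (φ ∧ᵈ ψ)     X'⊆X       = ×-map (sat-antimono ρ φ X'⊆X) (sat-antimono ρ ψ X'⊆X)
    sat-antimono ρ (∃ᵈ v φ)     X'⊆X (F , h) =
      (λ s → F s ∘ X'⊆X s) , sat-antimono ρ φ (λ { _ (s , hs , e) → s , X'⊆X s hs , e }) h
    sat-antimono ρ (∀ᵈ v φ)     X'⊆X h     =
      sat-antimono ρ φ (λ { _ (s , hs , m , e) → s , X'⊆X s hs , m , e }) h
    sat-antimono ρ (∃² P φ)     X'⊆X (Q , h) = Q , sat-antimono _ φ X'⊆X h

    sat-empty : ∀ ρ φ {X : Team D} → (∀ s → ¬ X s) → sat ρ φ X
    sat-empty ρ ⊤ᵈ           _       = lift tt
    sat-empty ρ (R t a b c)  X-empty = lift (λ s → ⊥-elim ∘ X-empty s)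
    sat-empty ρ (¬R t a b c) X-empty = lift (λ s → ⊥-elim ∘ X-empty s)
    sat-empty ρ (Vr p a b)   X-empty = lift (λ s → ⊥-elim ∘ X-empty s)
    sat-empty ρ (¬Vr p a b)  X-empty = lift (λ s → ⊥-elim ∘ X-empty s)
    sat-empty ρ (Pr P a)     X-empty = lift (λ s → ⊥-elim ∘ X-empty s)
    sat-empty ρ (¬Pr P a)    X-empty = lift (λ s → ⊥-elim ∘ X-empty s)
    sat-empty ρ (eq a b)     X-empty = lift (λ s → ⊥-elim ∘ X-empty s)
    sat-empty ρ (neq a b)    X-empty = lift (λ s → ⊥-elim ∘ X-empty s)
    sat-empty ρ (dep vs v)   X-empty = lift (λ s _ hs → ⊥-elim (X-empty s hs))
    sat-empty ρ (φ ∨ᵈ ψ)     X-empty = _ , _ , lift (∪-idem _) , sat-empty ρ φ X-empty , sat-empty ρ ψ X-empty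
    sat-empty ρ (φ ∧ᵈ ψ)     X-empty = sat-empty ρ φ X-empty , sat-empty ρ ψ X-empty
    sat-empty ρ (∃ᵈ v φ)     X-empty =
      (λ s → ⊥-elim ∘ X-empty s) , sat-empty ρ φ (λ { _ (s , hs , _) → X-empty s hs })
    sat-empty ρ (∀ᵈ v φ)     X-empty = sat-empty ρ φ (λ { _ (s , hs , _) → X-empty s hs })
    sat-empty ρ (∃² P φ)     X-empty = ∅ , sat-empty _ φ X-empty

    Flat : (RVar → Sub D) → DLForm Θ Φ → (Assign D → Set) → Set₁
    Flat ρ α p = ∀ {X} → sat ρ α X ⇔ (∀ s → X s → p s)

    ¬Pr-flat : ∀ ρ P v → Flat ρ (¬Pr P v) (λ s → ¬ ρ P (s v))
    ¬Pr-flat ρ P v = mk⇔ lower lift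

    ¬R-flat : ∀ ρ t a b c → Flat ρ (¬R t a b c) (λ s → ¬ Rᴹ t (s a) (s b) (s c))
    ¬R-flat ρ t a b c = mk⇔ lower lift

    ∨-guard : ExcludedMiddle 0ℓ → ∀ ρ α φ {p : Assign D → Set} {X : Team D} → Flat ρ α (¬_ ∘ p) →
              sat ρ (α ∨ᵈ φ) X ⇔ sat ρ φ (λ s → X s × p s)
    ∨-guard em ρ α φ {p} {X} α-flat = mk⇔ guarded unguarded
      where
      guarded : sat ρ (α ∨ᵈ φ) X → sat ρ φ (λ s → X s × p s)
      guarded (Y₁ , Y₂ , lift (X⊆Y₁∪Y₂ , _) , hα , hφ) = sat-antimono ρ φ inY₂ hφ
        where
        inY₂ : ∀ s → X s × p s → Y₂ s
        inY₂ s (hs , ps) with X⊆Y₁∪Y₂ s hs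
        ... | inj₁ y₁ = ⊥-elim (to α-flat hα s y₁ ps)
        ... | inj₂ y₂ = y₂
      unguarded : sat ρ φ (λ s → X s × p s) → sat ρ (α ∨ᵈ φ) X
      unguarded hφ =
        (λ s → X s × ¬ p s) , (λ s → X s × p s) ,
        lift ((λ s hs → ⊎-map (hs ,_) (hs ,_) (swap (toSum (em {p s})))) , (λ s → [ proj₁ , proj₁ ])) ,
        from α-flat (λ _ → proj₂) , hφ

    const-agree : ∀ ρ v {X : Team D} → sat ρ (const v) X → ∀ {s s'} → X s → X s' → s v ≡ s' v
    const-agree ρ v (lift h) hs hs' = h _ _ hs hs' []

    const-intro : ∀ ρ v {X : Team D} d → (∀ s → X s → s v ≡ d) → sat ρ (const v) X
    const-intro ρ v d X≡d = lift (λ s s' hs hs' _ → trans (X≡d s hs) (sym (X≡d s' hs')))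

  module _ {D : Set} where

    supplementConst : Team D → Var → D → Team D
    supplementConst X v d = supplement X v (λ _ _ → d)

    supplement⊆duplicate : ∀ (X : Team D) v F → supplement X v F ⊆ duplicate X v
    supplement⊆duplicate X v F _ (s , hs , e) = s , hs , F s hs , e

    supplement-∋ : ∀ (X : Team D) v F {s} (hs : X s) → supplement X v F (s [ v ↦ F s hs ])
    supplement-∋ X v F hs = _ , hs , λ _ → refl

    duplicate-∋ : ∀ (X : Team D) v {s} m → X s → duplicate X v (s [ v ↦ m ])
    duplicate-∋ X v m hs = _ , hs , m , λ _ → refl

    supplementConst-at : ∀ (X : Team D) v d {s} → supplementConst X v d s → s v ≡ d
    supplementConst-at X v d (_ , _ , e) = trans (e v) (if-≡ᵇ-refl v)

    duplicate-elsewhere : ∀ (X : Team D) v {w} → w ≢ v → ∀ {s} → duplicate X v s →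
                          Σ (Assign D) λ s₀ → X s₀ × s w ≡ s₀ w
    duplicate-elsewhere X v w≢v (s₀ , hs₀ , _ , e) = s₀ , hs₀ , trans (e _) (if-≡ᵇ-≢ _ v w≢v)

  module Translation (em : ExcludedMiddle 0ℓ) {Θ Φ : Set} (T : TransitionModel Θ Φ) (E : Enumeration T) where
    open TransitionModel T
    open Enumeration E
    open IsTransitionSystem
    open IsTrump
    open TLSem T
    open TLProperties T
    open DLSem (Tᴰᴸ T E)
    open DLProperties (Tᴰᴸ T E)

    D : Set
    D = Dom T E

    values : Team D → Var → Sub S
    values = valuesIn T E

    InS : Team D → Var → Set
    InS = ValuesInS T E

    actionIndex : (t : Θ) → I t → D
    actionIndex t i = inj₂ (inj₁ (t , i))

    atomIndex : (p : Φ) → J p → D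
    atomIndex p j = inj₂ (inj₂ (p , j))

    Antitone : (Sub S → Set₁) → Set₁
    Antitone a = ∀ {U U'} → U' ⊆ U → a U → a U'

    record Expresses (ρ : RVar → Sub D) (A : DLForm Θ Φ) (a : Sub S → Set₁) (x : Var) : Set₁ where
      constructor expressing
      field
        equiv : ∀ {X} → InS X x → sat ρ A X ⇔ a (values X x)

    open Expresses

    valueAt : ∀ {X} x → InS X x → ∀ {s} → X s → Σ S λ c → s x ≡ inj₁ c × values X x c
    valueAt x inS {s} hs = proj₁ (inS s hs) , proj₂ (inS s hs) , s , hs , proj₂ (inS s hs)

    values-mono : ∀ {X Y} x → Y ⊆ X → values Y x ⊆ values X x
    values-mono x Y⊆X _ (s , hs , e) = s , Y⊆X s hs , e

    inS-antimono : ∀ {X Y} x → Y ⊆ X → InS X x → InS Y x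
    inS-antimono x Y⊆X inS s = inS s ∘ Y⊆X s

    values-empty : ∀ {X} x → (∀ s → ¬ X s) → values X x ⊆ ∅
    values-empty x X-empty _ (s , hs , _) = X-empty s hs

    values-duplicate : ∀ {X} v {x} → x ≢ v → values (duplicate X v) x ⊆ values X x
    values-duplicate v x≢v _ (s , hs , e) with duplicate-elsewhere _ v x≢v hs
    ... | s₀ , hs₀ , sx≡s₀x = s₀ , hs₀ , trans (sym sx≡s₀x) e

    inS-duplicate : ∀ {X} v {x} → x ≢ v → InS X x → InS (duplicate X v) x
    inS-duplicate v x≢v inS s hs with duplicate-elsewhere _ v x≢v hs
    ... | s₀ , hs₀ , sx≡s₀x = proj₁ (inS s₀ hs₀) , trans sx≡s₀x (proj₂ (inS s₀ hs₀))

    values-supplement : ∀ {X} v F {x} → x ≢ v → values (supplement X v F) x ≐ values X x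
    values-supplement {X} v F x≢v =
      (λ a → values-duplicate v x≢v a ∘ values-mono _ (supplement⊆duplicate X v F) a) ,
      (λ { _ (s , hs , e) → _ , supplement-∋ X v F hs , trans (if-≡ᵇ-≢ _ v x≢v) e })

    inS-supplement : ∀ {X} v F {x} → x ≢ v → InS X x → InS (supplement X v F) x
    inS-supplement {X} v F x≢v = inS-antimono _ (supplement⊆duplicate X v F) ∘ inS-duplicate v x≢v

    restrictTo : Team D → Var → Sub S → Team D
    restrictTo X x U s = X s × Σ S λ c → s x ≡ inj₁ c × U c

    inS-restrictTo : ∀ X x U → InS (restrictTo X x U) x
    inS-restrictTo X x U s (_ , c , e , _) = c , e

    values-restrictTo : ∀ X x U → values (restrictTo X x U) x ⊆ U
    values-restrictTo X x U c (s , (_ , c' , e' , u) , e) = subst U (inj₁-injective (trans (sym e') e)) u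

    Vᴰᴸ-index : ∀ {p d e} → Vᴰᴸ T E p d e → Σ (J p) λ j → d ≡ atomIndex p j
    Vᴰᴸ-index {d = inj₂ (inj₂ (_ , j))} {inj₁ _} (refl , _) = j , refl

    Vᴰᴸ-elim : ∀ {p j a d e} → d ≡ atomIndex p j → e ≡ inj₁ a → Vᴰᴸ T E p d e → Xⱼ p j a
    Vᴰᴸ-elim refl refl (_ , h) = h

    Vᴰᴸ-intro : ∀ {p j a d e} → d ≡ atomIndex p j → e ≡ inj₁ a → Xⱼ p j a → Vᴰᴸ T E p d e
    Vᴰᴸ-intro refl refl h = refl , h

    Rᴰᴸ-index : ∀ {t d e f} → Rᴰᴸ T E t d e f → Σ (I t) λ i → d ≡ actionIndex t i
    Rᴰᴸ-index {d = inj₂ (inj₁ (_ , i))} {inj₁ _} {inj₁ _} (refl , _) = i , refl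

    Rᴰᴸ-elim : ∀ {t i a d e f} → d ≡ actionIndex t i → e ≡ inj₁ a → Rᴰᴸ T E t d e f →
               Xᵢ t i a × Σ S λ b → f ≡ inj₁ b × Yᵢ t i b
    Rᴰᴸ-elim {f = inj₁ b} refl refl (_ , xa , yb) = xa , b , refl , yb

    Rᴰᴸ-intro : ∀ {t i a b d e f} → d ≡ actionIndex t i → e ≡ inj₁ a → f ≡ inj₁ b →
                Xᵢ t i a → Yᵢ t i b → Rᴰᴸ T E t d e f
    Rᴰᴸ-intro refl refl refl xa yb = refl , xa , yb

    embedSub-elim : ∀ {Z : Sub S} d → embedSub T E Z d → Σ S λ c → d ≡ inj₁ c × Z c
    embedSub-elim (inj₁ c) z = c , refl , z

    ∧-expresses : ∀ {ρ A B x} {a b : Sub S → Set₁} → Expresses ρ A a x → Expresses ρ B b x →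
                  Expresses ρ (A ∧ᵈ B) (λ U → a U × b U) x
    ∧-expresses hA hB = expressing λ inS →
      mk⇔ (×-map (to (equiv hA inS)) (to (equiv hB inS))) (×-map (from (equiv hA inS)) (from (equiv hB inS)))

    Pr-expresses : ∀ ρ P x → Expresses ρ (Pr P x) (λ U → Lift (lsuc 0ℓ) (U ⊆ λ c → ρ P (inj₁ c))) x
    Pr-expresses ρ P x = expressing λ inS →
      mk⇔ (λ { (lift h) → lift (λ { _ (s , hs , e) → subst (ρ P) e (h s hs) }) })
          (λ { (lift h) → lift (λ s hs → let c , e , hc = valueAt x inS hs in subst (ρ P) (sym e) (h c hc)) })

    Split : (Sub S → Set₁) → (Sub S → Set₁) → Sub S → Set₁
    Split a b U = Σ (Sub S) λ U₁ → Σ (Sub S) λ U₂ → Lift (lsuc 0ℓ) (U ≐ (U₁ ∪ U₂)) × a U₁ × b U₂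

    ∨-expresses : ∀ {ρ A B x} {a b : Sub S → Set₁} → Antitone a → Antitone b →
      Expresses ρ A a x → Expresses ρ B b x → Expresses ρ (A ∨ᵈ B) (Split a b) x
    ∨-expresses {ρ} {A} {B} {x} {a} {b} a-antimono b-antimono hA hB = expressing equivalence
      where
      equivalence : ∀ {X} → InS X x → sat ρ (A ∨ᵈ B) X ⇔ Split a b (values X x)
      equivalence {X} inS = mk⇔ sound complete
        where
        sound : sat ρ (A ∨ᵈ B) X → Split a b (values X x)
        sound (Y₁ , Y₂ , lift (X⊆Y₁∪Y₂ , Y₁∪Y₂⊆X) , h₁ , h₂) =
          values Y₁ x , values Y₂ x ,
          lift ((λ { c (s , hs , e) → ⊎-map (λ y₁ → s , y₁ , e) (λ y₂ → s , y₂ , e) (X⊆Y₁∪Y₂ s hs) }) ,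
                (λ c → [ values-mono x (λ s → Y₁∪Y₂⊆X s ∘ inj₁) c , values-mono x (λ s → Y₁∪Y₂⊆X s ∘ inj₂) c ])) ,
          to (equiv hA (inS-antimono x (λ s → Y₁∪Y₂⊆X s ∘ inj₁) inS)) h₁ ,
          to (equiv hB (inS-antimono x (λ s → Y₁∪Y₂⊆X s ∘ inj₂) inS)) h₂
        complete : Split a b (values X x) → sat ρ (A ∨ᵈ B) X
        complete (U₁ , U₂ , lift (values⊆U₁∪U₂ , _) , h₁ , h₂) =
          restrictTo X x U₁ , restrictTo X x U₂ ,
          lift ((λ s hs → let c , e , hc = valueAt x inS hs
                          in ⊎-map (λ u → hs , c , e , u) (λ u → hs , c , e , u) (values⊆U₁∪U₂ c hc)) ,
                (λ s → [ proj₁ , proj₁ ])) ,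
          from (equiv hA (inS-restrictTo X x U₁)) (a-antimono (values-restrictTo X x U₁) h₁) ,
          from (equiv hB (inS-restrictTo X x U₂)) (b-antimono (values-restrictTo X x U₂) h₂)

    atom-expresses : ∀ {ρ p x n} → x ≢ n → Expresses ρ (trF (atom p) x n) (satF (atom p)) x
    atom-expresses {ρ} {p} {x} {n} x≢n = expressing equivalence
      where
      equivalence : ∀ {X} → InS X x → sat ρ (trF (atom p) x n) X ⇔ satF (atom p) (values X x)
      equivalence {X} inS = mk⇔ sound complete
        where
        sound : sat ρ (trF (atom p) x n) X → satF (atom p) (values X x)
        sound (F , hconst , lift hV) with em {Σ (Assign D) X}
        ... | no X-empty = satF-empty (atom p) (values-empty x (λ s hs → X-empty (s , hs)))
        ... | yes (s₀ , hs₀) = lift (downClosed (V-tr p) _ _ (J-sound p j) values⊆Xⱼ)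
          where
          hy₀ : supplement X n F (s₀ [ n ↦ F s₀ hs₀ ])
          hy₀ = supplement-∋ X n F hs₀
          j : J p
          j = proj₁ (Vᴰᴸ-index (hV _ hy₀))
          values⊆Xⱼ : values X x ⊆ Xⱼ p j
          values⊆Xⱼ c hc with proj₂ (values-supplement n F x≢n) c hc
          ... | y , hy , yx≡c =
            Vᴰᴸ-elim (trans (const-agree ρ n hconst hy hy₀) (proj₂ (Vᴰᴸ-index (hV _ hy₀)))) yx≡c (hV y hy)
        complete : satF (atom p) (values X x) → sat ρ (trF (atom p) x n) X
        complete (lift hp) =
          (λ _ _ → atomIndex p j) , const-intro ρ n _ (λ _ → supplementConst-at X n _) , lift hV
          where
          j : J p
          j = proj₁ (J-complete p _ hp)
          hV : ∀ y → supplementConst X n (atomIndex p j) y → Vᴰᴸ T E p (y n) (y x)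
          hV y hy = let c , yx≡c , hc = valueAt x (inS-supplement n _ x≢n inS) hy in
            Vᴰᴸ-intro (supplementConst-at X n _ hy) yx≡c
              (proj₂ (proj₂ (J-complete p _ hp)) c (proj₁ (values-supplement n _ x≢n) c hc))

    module _ {ρ : RVar → Sub D} {t : Θ} {x P n : Var} (x≢n : x ≢ n) (x≢n' : x ≢ suc n) where

      private
        n≢n' : n ≢ suc n
        n≢n' = ≢-sym 1+n≢n

        target : Sub S
        target c = ρ P (inj₁ c)

      act-sound : ∀ {X} → InS X x → sat ρ (trT (act t) x P n) X → satT (act t) (values X x) target
      act-sound {X} inS (F , hconst , (G , lift hR) , hall) with em {Σ (Assign D) X}
      ... | no X-empty = satT-empty (act t) (values-empty x (λ s hs → X-empty (s , hs)))
      ... | yes (s₀ , hs₀) =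
        lift (upSecond (θ-ts t) _ _ _ (downFirst (θ-ts t) _ _ _ (I-sound t i) values⊆Xᵢ) Yᵢ⊆target)
        where
        Y : Team D
        Y = supplement X n F
        hy₀ : Y (s₀ [ n ↦ F s₀ hs₀ ])
        hy₀ = supplement-∋ X n F hs₀
        hz₀ : supplement Y (suc n) G ((s₀ [ n ↦ F s₀ hs₀ ]) [ suc n ↦ G _ hy₀ ])
        hz₀ = supplement-∋ Y (suc n) G hy₀
        i : I t
        i = proj₁ (Rᴰᴸ-index (hR _ hz₀))
        indexed : ∀ {w} → duplicate Y (suc n) w → w n ≡ actionIndex t i
        indexed hw with duplicate-elsewhere Y (suc n) n≢n' hw
                      | duplicate-elsewhere Y (suc n) n≢n' (supplement⊆duplicate Y (suc n) G _ hz₀)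
        ... | y , hy , wn≡yn | y₀ , hy₀' , z₀n≡y₀n =
          trans wn≡yn (trans (const-agree ρ n hconst hy hy₀')
                             (trans (sym z₀n≡y₀n) (proj₂ (Rᴰᴸ-index (hR _ hz₀)))))
        values⊆Xᵢ : values X x ⊆ Xᵢ t i
        values⊆Xᵢ c hc with proj₂ (values-supplement (suc n) G x≢n') c (proj₂ (values-supplement n F x≢n) c hc)
        ... | w , hw , wx≡c =
          proj₁ (Rᴰᴸ-elim (indexed (supplement⊆duplicate Y (suc n) G w hw)) wx≡c (hR w hw))
        Yᵢ⊆target : Yᵢ t i ⊆ target
        Yᵢ⊆target b yb with valueAt x inS hs₀
        ... | a₀ , s₀x≡a₀ , ha₀ = subst (ρ P) (if-≡ᵇ-refl (suc n)) (lower guarded w (hw , r))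
          where
          w : Assign D
          w = (s₀ [ n ↦ F s₀ hs₀ ]) [ suc n ↦ inj₁ b ]
          hw : duplicate Y (suc n) w
          hw = duplicate-∋ Y (suc n) (inj₁ b) hy₀
          r : Rᴰᴸ T E t (w n) (w x) (w (suc n))
          r = Rᴰᴸ-intro (indexed hw) (trans (if-≡ᵇ-≢ x (suc n) x≢n') (trans (if-≡ᵇ-≢ x n x≢n) s₀x≡a₀))
                        (if-≡ᵇ-refl (suc n)) (values⊆Xᵢ a₀ ha₀) yb
          guarded : sat ρ (Pr P (suc n)) (λ w → duplicate Y (suc n) w × Rᴰᴸ T E t (w n) (w x) (w (suc n)))
          guarded = to (∨-guard em ρ (¬R t n x (suc n)) (Pr P (suc n)) (¬R-flat ρ t n x (suc n))) hall

      act-complete : ∀ {X} → InS X x → satT (act t) (values X x) target → sat ρ (trT (act t) x P n) X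
      act-complete {X} inS (lift hθ) = build (em {Σ S (Yᵢ t i)})
        where
        i : I t
        i = proj₁ (I-complete t _ _ hθ)
        Xᵢ≐values : Xᵢ t i ≐ values X x
        Xᵢ≐values = proj₁ (proj₂ (I-complete t _ _ hθ))
        Yᵢ≐target : Yᵢ t i ≐ target
        Yᵢ≐target = proj₂ (proj₂ (I-complete t _ _ hθ))
        Y : Team D
        Y = supplementConst X n (actionIndex t i)
        indexed : ∀ {w} → duplicate Y (suc n) w → w n ≡ actionIndex t i
        indexed hw with duplicate-elsewhere Y (suc n) n≢n' hw
        ... | y , hy , wn≡yn = trans wn≡yn (supplementConst-at X n _ hy)
        source : ∀ {w} → duplicate Y (suc n) w → Σ S λ a → w x ≡ inj₁ a × Xᵢ t i a
        source hw with valueAt x (inS-duplicate (suc n) x≢n' (inS-supplement n _ x≢n inS)) hw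
        ... | a , wx≡a , ha =
          a , wx≡a ,
          proj₂ Xᵢ≐values a (proj₁ (values-supplement n _ x≢n) a (values-duplicate (suc n) x≢n' a ha))
        -- Yᵢ is nonempty unless Xᵢ, and hence X, is empty.
        build : Dec (Σ S (Yᵢ t i)) → sat ρ (trT (act t) x P n) X
        build (no Yᵢ-empty) = sat-empty ρ (trT (act t) x P n) X-empty
          where
          X-empty : ∀ s → ¬ X s
          X-empty s hs with valueAt x inS hs
          ... | a , _ , ha = noEmptySecond (θ-ts t) (Xᵢ t i)
            (upSecond (θ-ts t) _ _ ∅ (I-sound t i) (λ b yb → Yᵢ-empty (b , yb))) a (proj₂ Xᵢ≐values a ha)
        build (yes (b₀ , yb₀)) =
          (λ _ _ → actionIndex t i) , const-intro ρ n _ (λ _ → supplementConst-at X n _) ,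
          ((λ _ _ → inj₁ b₀) , lift hR) ,
          from (∨-guard em ρ (¬R t n x (suc n)) (Pr P (suc n)) (¬R-flat ρ t n x (suc n))) (lift hP)
          where
          hR : ∀ w → supplementConst Y (suc n) (inj₁ b₀) w → Rᴰᴸ T E t (w n) (w x) (w (suc n))
          hR w hw with source (supplement⊆duplicate Y (suc n) _ w hw)
          ... | a , wx≡a , ha =
            Rᴰᴸ-intro (indexed (supplement⊆duplicate Y (suc n) _ w hw)) wx≡a
                      (supplementConst-at Y (suc n) _ hw) ha yb₀
          hP : ∀ w → duplicate Y (suc n) w × Rᴰᴸ T E t (w n) (w x) (w (suc n)) → ρ P (w (suc n))
          hP w (hw , r) with source hw
          ... | a , wx≡a , _ with Rᴰᴸ-elim (indexed hw) wx≡a r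
          ... | _ , b , wn'≡b , yb = subst (ρ P) (sym wn'≡b) (proj₁ Yᵢ≐target b yb)

      act-expresses : Expresses ρ (trT (act t) x P n) (λ U → satT (act t) U target) x
      act-expresses = expressing λ inS → mk⇔ (act-sound inS) (act-complete inS)

    module _ {ρ : RVar → Sub D} {A B : DLForm Θ Φ} {x n : Var} {a b : Sub S → Set₁}
             (x≢n : x ≢ n) (x≢n' : x ≢ suc n) (a-antimono : Antitone a) (b-antimono : Antitone b)
             (hA : Expresses ρ A a x) (hB : Expresses ρ B b x) where

      private
        n≢n' : n ≢ suc n
        n≢n' = ≢-sym 1+n≢n

      cdisj-sound : a ∅ → ∀ {X} → InS X x → sat ρ (cdisj n (suc n) A B) X → a (values X x) ⊎ b (values X x)
      cdisj-sound a-∅ {X} inS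
        (F₁ , F₂ , (c₁ , c₂) , Y₁ , Y₂ , lift (Y⊆Y₁∪Y₂ , Y₁∪Y₂⊆Y) , (lift eq₁ , hA₁) , (lift neq₂ , hB₂))
        with em {Σ (Assign D) X}
      ... | no X-empty = inj₁ (a-antimono (values-empty x (λ s hs → X-empty (s , hs))) a-∅)
      ... | yes (s₀ , hs₀) = [ inj₁ ∘ onlyY₁ , inj₂ ∘ onlyY₂ ] (Y⊆Y₁∪Y₂ _ hy₀)
        where
        X₁ : Team D
        X₁ = supplement X n F₁
        Y : Team D
        Y = supplement X₁ (suc n) F₂
        hy₀ : Y ((s₀ [ n ↦ F₁ s₀ hs₀ ]) [ suc n ↦ F₂ _ (supplement-∋ X n F₁ hs₀) ])
        hy₀ = supplement-∋ X₁ (suc n) F₂ (supplement-∋ X n F₁ hs₀)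
        -- u₁ and u₂ are constant on Y, so they agree either everywhere on Y or nowhere.
        diagonal : ∀ {y y'} → Y y → Y y' → y n ≡ y (suc n) → y' n ≡ y' (suc n)
        diagonal hy hy' e = trans (const-agree ρ n c₁ hy' hy) (trans e (const-agree ρ (suc n) c₂ hy hy'))
        inS-Y : InS Y x
        inS-Y = inS-supplement (suc n) F₂ x≢n' (inS-supplement n F₁ x≢n inS)
        values⊆values-Y : values X x ⊆ values Y x
        values⊆values-Y c = proj₂ (values-supplement (suc n) F₂ x≢n') c ∘ proj₂ (values-supplement n F₁ x≢n) c
        conclude : ∀ C {c : Sub S → Set₁} {Yᵢ : Team D} → Antitone c → Expresses ρ C c x →
                   Yᵢ ⊆ Y → Y ⊆ Yᵢ → sat ρ C Yᵢ → c (values X x)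
        conclude C c-antimono hC Yᵢ⊆Y Y⊆Yᵢ h =
          c-antimono (λ c → values-mono x Y⊆Yᵢ c ∘ values⊆values-Y c)
                     (to (equiv hC (inS-antimono x Yᵢ⊆Y inS-Y)) h)
        onlyY₁ : Y₁ _ → a (values X x)
        onlyY₁ y₀∈Y₁ = conclude A a-antimono hA (λ s → Y₁∪Y₂⊆Y s ∘ inj₁) Y⊆Y₁ hA₁
          where
          Y⊆Y₁ : Y ⊆ Y₁
          Y⊆Y₁ y hy =
            [ id , (λ y₂ → ⊥-elim (neq₂ y y₂ (diagonal hy₀ hy (eq₁ _ y₀∈Y₁)))) ] (Y⊆Y₁∪Y₂ y hy)
        onlyY₂ : Y₂ _ → b (values X x)
        onlyY₂ y₀∈Y₂ = conclude B b-antimono hB (λ s → Y₁∪Y₂⊆Y s ∘ inj₂) Y⊆Y₂ hB₂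
          where
          Y⊆Y₂ : Y ⊆ Y₂
          Y⊆Y₂ y hy =
            [ (λ y₁ → ⊥-elim (neq₂ _ y₀∈Y₂ (diagonal hy hy₀ (eq₁ y y₁)))) , id ] (Y⊆Y₁∪Y₂ y hy)

      cdisj-intro : ∀ {X} → InS X x → (d₁ d₂ : D) →
                    (d₁ ≡ d₂ × a (values X x)) ⊎ (d₁ ≢ d₂ × b (values X x)) → sat ρ (cdisj n (suc n) A B) X
      cdisj-intro {X} inS d₁ d₂ h =
        (λ _ _ → d₁) , (λ _ _ → d₂) , (const-intro ρ n d₁ Y-at-n , const-intro ρ (suc n) d₂ Y-at-n') , body h
        where
        X₁ : Team D
        X₁ = supplementConst X n d₁
        Y : Team D
        Y = supplementConst X₁ (suc n) d₂
        Y-at-n : ∀ y → Y y → y n ≡ d₁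
        Y-at-n y hy with duplicate-elsewhere X₁ (suc n) n≢n' (supplement⊆duplicate X₁ (suc n) _ y hy)
        ... | _ , hy₁ , yn≡y₁n = trans yn≡y₁n (supplementConst-at X n d₁ hy₁)
        Y-at-n' : ∀ y → Y y → y (suc n) ≡ d₂
        Y-at-n' _ = supplementConst-at X₁ (suc n) d₂
        inS-Y : InS Y x
        inS-Y = inS-supplement (suc n) _ x≢n' (inS-supplement n _ x≢n inS)
        values-Y⊆values : values Y x ⊆ values X x
        values-Y⊆values c = proj₁ (values-supplement n _ x≢n) c ∘ proj₁ (values-supplement (suc n) _ x≢n') c
        body : (d₁ ≡ d₂ × a (values X x)) ⊎ (d₁ ≢ d₂ × b (values X x)) →
               sat ρ ((eq n (suc n) ∧ᵈ A) ∨ᵈ (neq n (suc n) ∧ᵈ B)) Y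
        body (inj₁ (d₁≡d₂ , ha)) =
          Y , ∅ , lift ((λ _ → inj₁) , (λ _ → [ id , ⊥-elim ])) ,
          (lift (λ y hy → trans (Y-at-n y hy) (trans d₁≡d₂ (sym (Y-at-n' y hy)))) ,
           from (equiv hA inS-Y) (a-antimono values-Y⊆values ha)) ,
          sat-empty ρ (neq n (suc n) ∧ᵈ B) (λ _ ())
        body (inj₂ (d₁≢d₂ , hb)) =
          ∅ , Y , lift ((λ _ → inj₂) , (λ _ → [ ⊥-elim , id ])) ,
          sat-empty ρ (eq n (suc n) ∧ᵈ A) (λ _ ()) ,
          (lift (λ y hy yn≡yn' → d₁≢d₂ (trans (sym (Y-at-n y hy)) (trans yn≡yn' (Y-at-n' y hy)))) ,
           from (equiv hB inS-Y) (b-antimono values-Y⊆values hb))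

      -- The right disjunct needs a value for u₂ different from that of u₁. If T^DL has a single element,
      -- T has no actions and no atoms, and then the left disjunct holds anyway.
      cdisj-expresses : a ∅ → (Σ D (inj₁ point ≢_)) ⊎ (∀ U → a U) →
                        Expresses ρ (cdisj n (suc n) A B) (λ U → a U ⊎ b U) x
      cdisj-expresses a-∅ separated = expressing equivalence
        where
        equivalence : ∀ {X} → InS X x → sat ρ (cdisj n (suc n) A B) X ⇔ (a (values X x) ⊎ b (values X x))
        equivalence {X} inS = mk⇔ (cdisj-sound a-∅ inS) complete
          where
          complete : a (values X x) ⊎ b (values X x) → sat ρ (cdisj n (suc n) A B) X
          complete (inj₁ ha) = cdisj-intro inS (inj₁ point) (inj₁ point) (inj₁ (refl , ha))
          complete (inj₂ hb) =
            [ (λ { (d , point≢d) → cdisj-intro inS (inj₁ point) d (inj₂ (point≢d , hb)) }) ,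
              (λ always-a → cdisj-intro inS (inj₁ point) (inj₁ point) (inj₁ (refl , always-a _))) ] separated

    module _ {ρ : RVar → Sub D} {A B : DLForm Θ Φ} {x n : Var} {a : Sub S → Sub S → Set₁} {b : Sub S → Set₁}
             (a-monoʳ : ∀ {U Z Z'} → Z ⊆ Z' → a U Z → a U Z') (b-antimono : Antitone b)
             (a-empty : ∀ {U} Z → (∀ c → ¬ U c) → a U Z) (b-∅ : b ∅)
             (hA : ∀ Q → Expresses (ρ [ n ↦ᴿ Q ]) A (λ U → a U (λ c → (ρ [ n ↦ᴿ Q ]) n (inj₁ c))) x)
             (hB : ∀ Q → Expresses (ρ [ n ↦ᴿ Q ]) B b n) where

      modality-sound : ∀ {X} → InS X x → sat ρ (∃² n (A ∧ᵈ ∀ᵈ n (¬Pr n n ∨ᵈ B))) X →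
                       Σ (Sub S) λ Z → a (values X x) Z × b Z
      modality-sound {X} inS (Q , hAX , hall) with em {Σ (Assign D) X}
      ... | no X-empty = ∅ , a-empty ∅ (values-empty x (λ s hs → X-empty (s , hs))) , b-∅
      ... | yes (s₀ , hs₀) =
        values W n , a-monoʳ Qˢ⊆values-W (to (equiv (hA Q) inS) hAX) , to (equiv (hB Q) (inS-restrictTo _ n Qˢ)) hBW
        where
        ρ' : RVar → Sub D
        ρ' = ρ [ n ↦ᴿ Q ]
        Qˢ : Sub S
        Qˢ c = ρ' n (inj₁ c)
        W : Team D
        W = restrictTo (duplicate X n) n Qˢ
        hBW : sat ρ' B W
        hBW = sat-antimono ρ' B (λ { s (hs , c , sn≡c , q) → hs , subst (ρ' n) (sym sn≡c) q })
                                (to (∨-guard em ρ' (¬Pr n n) B (¬Pr-flat ρ' n n)) hall)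
        Qˢ⊆values-W : Qˢ ⊆ values W n
        Qˢ⊆values-W c q = _ , (duplicate-∋ X n (inj₁ c) hs₀ , c , if-≡ᵇ-refl n , q) , if-≡ᵇ-refl n

      modality-complete : ∀ {X} → InS X x → (Σ (Sub S) λ Z → a (values X x) Z × b Z) →
                          sat ρ (∃² n (A ∧ᵈ ∀ᵈ n (¬Pr n n ∨ᵈ B))) X
      modality-complete {X} inS (Z , haZ , hbZ) =
        Q , from (equiv (hA Q) inS) (subst (λ R → a (values X x) (λ c → R (inj₁ c))) (sym ρ'n≡Q) haZ) ,
        from (∨-guard em ρ' (¬Pr n n) B (¬Pr-flat ρ' n n))
             (sat-antimono ρ' B guarded⊆W
               (from (equiv (hB Q) (inS-restrictTo _ n Z)) (b-antimono (values-restrictTo _ n Z) hbZ)))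
        where
        Q : Sub D
        Q = embedSub T E Z
        ρ' : RVar → Sub D
        ρ' = ρ [ n ↦ᴿ Q ]
        ρ'n≡Q : ρ' n ≡ Q
        ρ'n≡Q = if-≡ᵇ-refl n
        guarded⊆W : (λ s → duplicate X n s × ρ' n (s n)) ⊆ restrictTo (duplicate X n) n Z
        guarded⊆W s (hs , q) = hs , embedSub-elim (s n) (subst (λ R → R (s n)) ρ'n≡Q q)

      modality-expresses :
        Expresses ρ (∃² n (A ∧ᵈ ∀ᵈ n (¬Pr n n ∨ᵈ B))) (λ U → Σ (Sub S) λ Z → a U Z × b Z) x
      modality-expresses = expressing λ inS → mk⇔ (modality-sound inS) (modality-complete inS)

    separated-or-degenerate : (Σ D (inj₁ point ≢_)) ⊎ (∀ φ U → satF φ U)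
    separated-or-degenerate with em {Σ Θ I ⊎ Σ Φ J}
    ... | yes w  = inj₁ (inj₂ w , λ ())
    ... | no ¬w = inj₂ (Degenerate.satF-degenerate noAction noAtom)
      where
      noAction : Θ → ⊥
      noAction t = ¬w (inj₁ (t , proj₁ (I-complete t _ _ (proj₂ (proj₂ (nonempty (θ-ts t)))))))
      noAtom : Φ → ⊥
      noAtom p = ¬w (inj₂ (p , proj₁ (J-complete p _ (proj₂ (nonempty (V-tr p))))))

    mutual
      trF-expresses : ∀ φ {x n} → x < n → ∀ ρ → Expresses ρ (trF φ x n) (satF φ) x
      trF-expresses ⊤ᶠ        _   ρ = expressing λ _ → mk⇔ (λ _ → lift tt) (λ _ → lift tt)
      trF-expresses (atom p)  x<n ρ = atom-expresses (<⇒≢ x<n)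
      trF-expresses (φ ∨ᶠ ψ)  {x} {n} x<n ρ =
        cdisj-expresses (<⇒≢ x<n) (<⇒≢ (m<n⇒m<1+n x<n)) (satF-antimono φ) (satF-antimono ψ)
          (trF-expresses φ x<n+2 ρ) (trF-expresses ψ x<n+2 ρ)
          (satF-empty φ (λ _ ())) (⊎-map id (λ always → always φ) separated-or-degenerate)
        where
        x<n+2 : x < suc (suc n)
        x<n+2 = m<n⇒m<1+n (m<n⇒m<1+n x<n)
      trF-expresses (φ ∧ᶠ ψ)  x<n ρ = ∧-expresses (trF-expresses φ x<n ρ) (trF-expresses ψ x<n ρ)
      trF-expresses (⟨ τ ⟩ ψ) {n = n} x<n ρ =
        modality-expresses (satT-monoʳ τ) (satF-antimono ψ) (λ _ → satT-empty τ) (satF-empty ψ (λ _ ()))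
          (λ Q → trT-expresses τ (m<n⇒m<1+n x<n) (n<1+n n) (ρ [ n ↦ᴿ Q ]))
          (λ Q → trF-expresses ψ (n<1+n n) (ρ [ n ↦ᴿ Q ]))

      trT-expresses : ∀ τ {x P n} → x < n → P < n → ∀ ρ →
                      Expresses ρ (trT τ x P n) (λ U → satT τ U (λ c → ρ P (inj₁ c))) x
      trT-expresses (act t)   x<n _ ρ = act-expresses (<⇒≢ x<n) (<⇒≢ (m<n⇒m<1+n x<n))
      trT-expresses (test φ)  {x} {P} x<n _ ρ = ∧-expresses (trF-expresses φ x<n ρ) (Pr-expresses ρ P x)
      trT-expresses (τ₁ ⊗ τ₂) x<n P<n ρ =
        ∨-expresses (satT-antimonoˡ τ₁) (satT-antimonoˡ τ₂)
          (trT-expresses τ₁ x<n P<n ρ) (trT-expresses τ₂ x<n P<n ρ)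
      trT-expresses (τ₁ ∩ τ₂) x<n P<n ρ =
        ∧-expresses (trT-expresses τ₁ x<n P<n ρ) (trT-expresses τ₂ x<n P<n ρ)
      trT-expresses (τ₁ ⨾ τ₂) {P = P} {n} x<n P<n ρ =
        modality-expresses (satT-monoʳ τ₁) (satT-antimonoˡ τ₂) (λ _ → satT-empty τ₁) (satT-empty τ₂ (λ _ ()))
          (λ Q → trT-expresses τ₁ (m<n⇒m<1+n x<n) (n<1+n n) (ρ [ n ↦ᴿ Q ]))
          (λ Q → subst (λ R → Expresses (ρ [ n ↦ᴿ Q ]) (trT τ₂ n P (suc n))
                                         (λ U → satT τ₂ U (λ c → R (inj₁ c))) n)
                       (if-≡ᵇ-≢ P n {Q} {ρ P} (<⇒≢ P<n))
                       (trT-expresses τ₂ (n<1+n n) (m<n⇒m<1+n P<n) (ρ [ n ↦ᴿ Q ])))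

mainTheorem5 : ExcludedMiddle 0ℓ → ExcludedMiddle (lsuc 0ℓ) →
    {Θ Φ : Set} (T : TransitionModel Θ Φ) (E : Enumeration T) →
    (∀ (φ : TLForm Θ Φ) (x : Var) (ρ : RVar → Sub (Dom T E)) (X : Team (Dom T E)) →
        ValuesInS T E X x →
        (DLSem.sat (Tᴰᴸ T E) ρ (φ ᴰᴸ[ x ]) X ⇔ TLSem.satF T φ (valuesIn T E X x)))
    ×
    (∀ (τ : TLTerm Θ Φ) (x : Var) (Pv : RVar) (P : Sub (TransitionModel.S T)) (X : Team (Dom T E)) →
        ValuesInS T E X x →
        (DLSem.sat (Tᴰᴸ T E) (λ _ → embedSub T E P) (τ ᴰᴸ[ x , Pv ]) X
          ⇔ TLSem.satT T τ (valuesIn T E X x) P))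
-- Excluded middle for Set suffices.
mainTheorem5 em _ T E = record
  { fst = λ φ x ρ X → equiv (trF-expresses φ (n<1+n x) ρ)
  ; snd = λ τ x Pv P X → equiv (trT-expresses τ (s≤s (m≤m⊔n x Pv)) (s≤s (m≤n⊔m x Pv)) (λ _ → embedSub T E P))
  }
  where
  open TranslationCorrectness.Translation em T E
  open Expresses
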